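{- Let $U$ be a tree topology and $f$ a nonnegative frequency vector with $\sum_{u\in U}f_u=1$. If some node $i$ has $f_i>\frac12$, then $i$ is the root of every STT $T$ over $U$ that minimizes $\mathrm{cost}(T,f)$.
   Context: An STT $T$ over a tree $U$ is defined recursively: pick a node $r$ as root; the subtrees of $r$ are STTs built recursively over the connected components of $U\setminus\{r\}$. $\mathrm{depth}_T(v)$ is the number of nodes on the path from $v$ to the root of $T$ inclusive (root has depth $1$), and $\mathrm{cost}(T,f)=\sum_{v\in U}f_v\,\mathrm{depth}_T(v)$.
   Formalization: The frequency vector f has rational entries. -}

module Defs where

open import Data.Nat using (ℕ; suc)
import Data.Nat
open import Data.Fin using (Fin)
open import Data.List using (List; []; _∷_; length; foldr; map; allFin)
open import Data.List.Relation.Unary.All using (All)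
open import Data.List.Relation.Unary.Any using (Any)
open import Data.List.Relation.Unary.AllPairs using (AllPairs)
open import Data.List.Relation.Unary.Linked using (Linked)
open import Data.List.Relation.Unary.Unique.Propositional using (Unique)
open import Data.List using (last; head)
open import Data.Maybe using (Maybe; just; nothing)
open import Data.Product using (_×_; ∃)
open import Data.Sum using (_⊎_)
open import Data.Empty using (⊥)
open import Data.Unit using (⊤)
open import Relation.Nullary using (¬_)
open import Relation.Binary.PropositionalEquality using (_≡_; _≢_)
open import Data.Rational using (ℚ; 0ℚ; 1ℚ; _+_; _*_; _≤_; _/_)
import Data.Rational as Q

data Reach {n : ℕ} (Adj : Fin n → Fin n → Set) (C : Fin n → Set)
           : Fin n → Fin n → Set where
  here : ∀ {u} → C u → Reach Adj C u u
  step : ∀ {u w v} → C u → Adj u w → Reach Adj C w v → Reach Adj C u v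

IsCycle : {n : ℕ} → (Fin n → Fin n → Set) → List (Fin n) → Set
IsCycle Adj vs =
  (3 Data.Nat.≤ length vs) × Unique vs × Linked Adj vs ×
  closes vs
  where
  closes : List _ → Set
  closes [] = ⊥
  closes (v ∷ ws) with last (v ∷ ws)
  ... | just w  = Adj w v
  ... | nothing = ⊥

record Tree (n : ℕ) : Set₁ where
  field
    Adj       : Fin n → Fin n → Set
    sym       : ∀ {u v} → Adj u v → Adj v u
    loopless  : ∀ {u} → ¬ Adj u u
    connected : ∀ u v → Reach Adj (λ _ → ⊤) u v
    acyclic   : ∀ vs → ¬ IsCycle Adj vs

data STT (n : ℕ) : Set where
  node : Fin n → List (STT n) → STT n

root : ∀ {n} → STT n → Fin n
root (node r _) = r

data _∈T_ {n : ℕ} (v : Fin n) : STT n → Set where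
  here  : ∀ {ts} → v ∈T node v ts
  there : ∀ {r ts} → Any (v ∈T_) ts → v ∈T node r ts

nodes : ∀ {n} → STT n → Fin n → Set
nodes T v = v ∈T T

module _ {n : ℕ} (G : Tree n) where
  open Tree G

  IsComponent : (Fin n → Set) → (Fin n → Set) → Set
  IsComponent X C =
    (∀ v → C v → X v) ×
    ∃ C ×
    (∀ u v → C u → C v → Reach Adj C u v) ×
    (∀ u w → C u → X w → Adj u w → C w)

  _∖_ : (Fin n → Set) → Fin n → Fin n → Set
  (X ∖ r) v = X v × v ≢ r

  data IsSTT (S : Fin n → Set) : STT n → Set where
    mk : ∀ {r ts} →
         S r →
         All (λ t → IsComponent (S ∖ r) (nodes t) × IsSTT (nodes t) t) ts →
         (∀ v → (S ∖ r) v → Any (v ∈T_) ts) →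
         AllPairs (λ t t′ → ∀ v → v ∈T t → v ∈T t′ → ⊥) ts →
         IsSTT S (node r ts)

  IsSTTover : STT n → Set
  IsSTTover = IsSTT (λ _ → ⊤)

fromℕ : ℕ → ℚ
fromℕ k = Data.Integer.+ k Q./ 1
  where import Data.Integer

module _ {n : ℕ} (f : Fin n → ℚ) where
  -- cost of T when its root sits at depth d (each vertex of a valid STT
  -- occurs exactly once, so this is Σ_v f_v · depth_T(v) for d = 1)
  costAt  : ℕ → STT n → ℚ
  costsAt : ℕ → List (STT n) → ℚ
  costAt d (node r ts) = f r * fromℕ d + costsAt (suc d) ts
  costsAt d [] = 0ℚ
  costsAt d (t ∷ ts) = costAt d t + costsAt d ts

  cost : STT n → ℚ
  cost = costAt 1

  total : ℚ
  total = foldr _+_ 0ℚ (map f (allFin n))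

IsOptimal : ∀ {n} → Tree n → (Fin n → ℚ) → STT n → Set
IsOptimal G f T = IsSTTover G T × (∀ T′ → IsSTTover G T′ → cost f T ≤ cost f T′)

{-# OPTIONS --safe #-}
module Submission where

-- Suppose the root of an optimal T is not i, and let p be the parent of i.
-- Rotate i above p: i becomes the root of p's subtree, p keeps its other
-- children os and adopts the children ms of i containing a neighbour of p
-- (by acyclicity there is at most one), while the other children ks of i stay
-- below i.  The result is again an STT on the same vertices.  Now i and ks
-- move up one level and p and os move down one, and the depth shift of a
-- subtree changes its cost by exactly its weight.  What moves down weighs less
-- than 1 - f i < ½ < f i, so the cost strictly drops; replacing the subtree at
-- p by the rotated one then makes T cheaper, contradicting optimality.
-- Children are ordered lists in this encoding, so they are freely permuted
-- (↭) to bring the relevant child to the front.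

open import Defs
open import Data.Nat using (ℕ)
open import Data.Fin using (Fin)
open import Data.Rational using (ℚ; 0ℚ; 1ℚ; ½; _≤_; _<_)
open import Relation.Binary.PropositionalEquality using (_≡_)

open import Data.Nat using (suc; zero)
import Data.Nat as ℕ
import Data.Nat.Properties as ℕ
import Data.Nat.Coprimality as Coprime
import Data.Integer as ℤ
open import Data.Rational using (mkℚ; _+_; _*_)
open import Data.Rational.Properties
  using ( normalize-coprime; +-0-isCommutativeMonoid; +-identityˡ; +-identityʳ; +-assoc; +-comm
        ; +-mono-≤; +-monoʳ-≤; +-monoˡ-≤; +-mono-<; +-monoʳ-<; +-monoˡ-<; +-mono-≤-<
        ; ≤-refl; ≤-trans; <-irrefl; ≤-<-trans; ≰⇒>; module ≤-Reasoning)
open import Data.Rational.Solver using (module +-*-Solver)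
open import Data.Fin using (_≟_)
open import Data.List using (List; []; _∷_; _++_; foldr; map; allFin; last; length)
import Data.List.Properties as List
open import Data.Maybe using (just)
open import Data.List.Relation.Unary.All as All using (All; []; _∷_)
import Data.List.Relation.Unary.All.Properties as All
open import Data.List.Relation.Unary.Any as Any using (Any; here; there)
import Data.List.Relation.Unary.Any.Properties as Any
open import Data.List.Relation.Unary.AllPairs as AllPairs using (AllPairs; []; _∷_)
import Data.List.Relation.Unary.AllPairs.Properties as AllPairs
open import Data.List.Relation.Unary.Linked using (Linked; [-]; _∷_)
open import Data.List.Relation.Unary.Unique.Propositional using (Unique)
import Data.List.Relation.Unary.Unique.Propositional.Properties as Unique
open import Data.List.Membership.Propositional using (_∈_; lose)
open import Data.List.Membership.Propositional.Properties using (∈-allFin)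
open import Data.List.Relation.Binary.Permutation.Propositional
  using (_↭_; ↭-refl; ↭-sym; ↭-trans; prep; swap; ↭⇒↭ₛ)
import Data.List.Relation.Binary.Permutation.Propositional.Properties as ↭
import Data.List.Relation.Binary.Permutation.Setoid.Properties as ↭ₛ
open import Data.Product using (_×_; _,_; proj₁; proj₂; ∃-syntax; ∃₂)
open import Data.Sum using (_⊎_; inj₁; inj₂)
open import Data.Empty using (⊥; ⊥-elim)
open import Data.Unit using (tt)
open import Relation.Nullary using (¬_; yes; no)
open import Relation.Unary using (_≐_)
open import Relation.Unary.Properties using (≐-sym)
open import Relation.Binary.PropositionalEquality
  using (_≢_; refl; sym; trans; cong; cong₂; subst; setoid; resp₂; module ≡-Reasoning)

fromℕ-suc : ∀ k → fromℕ (suc k) ≡ fromℕ k + 1ℚ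
fromℕ-suc zero    = refl
fromℕ-suc (suc k) = begin
  fromℕ (suc (suc k))      ≡⟨ cong (λ m → fromℕ (suc m)) (ℕ.+-comm 1 k) ⟩
  fromℕ (suc (k ℕ.+ 1))    ≡⟨ cong (λ m → fromℕ (suc (m ℕ.+ 1))) (ℕ.*-identityʳ k) ⟨
  mkℚ ℤ.+[1+ k ] 0 c + 1ℚ  ≡⟨ cong (_+ 1ℚ) (normalize-coprime c) ⟨
  fromℕ (suc k) + 1ℚ       ∎
  where
  open ≡-Reasoning
  c = Coprime.sym (Coprime.1-coprimeTo (suc k))

p≤p+q : ∀ {p q} → 0ℚ ≤ q → p ≤ p + q
p≤p+q {p} 0≤q = subst (_≤ p + _) (+-identityʳ p) (+-monoʳ-≤ p 0≤q)

p≤q+p : ∀ {p q} → 0ℚ ≤ q → p ≤ q + p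
p≤q+p {p} {q} 0≤q = subst (p ≤_) (+-comm p q) (p≤p+q 0≤q)

<-of-balance : ∀ {a b x y} → a + y ≡ b + x → x < y → a < b
<-of-balance {a} {b} {x} {y} balance x<y = ≰⇒> λ b≤a →
  <-irrefl refl (subst (b + x <_) balance (+-mono-≤-< b≤a x<y))

Any-extract : ∀ {A : Set} {P : A → Set} {xs} → Any P xs → ∃₂ λ x ys → P x × xs ↭ x ∷ ys
Any-extract {xs = x ∷ xs} (here px) = x , xs , px , ↭-refl
Any-extract {xs = x ∷ xs} (there a) with y , ys , py , π ← Any-extract a =
  y , x ∷ ys , py , ↭-trans (prep x π) (swap x y ↭-refl)

AllPairs-++⁻ : ∀ {A : Set} {R : A → A → Set} xs {ys} → AllPairs R (xs ++ ys) →
               AllPairs R xs × AllPairs R ys × All (λ x → All (R x) ys) xs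
AllPairs-++⁻ []       rs       = [] , rs , []
AllPairs-++⁻ (x ∷ xs) (r ∷ rs) with rxs , rys , cross ← AllPairs-++⁻ xs rs =
  All.++⁻ˡ xs r ∷ rxs , rys , All.++⁻ʳ xs r ∷ cross

sumℚ : List ℚ → ℚ
sumℚ = foldr _+_ 0ℚ

sumℚ-++ : ∀ xs ys → sumℚ (xs ++ ys) ≡ sumℚ xs + sumℚ ys
sumℚ-++ []       ys = sym (+-identityˡ (sumℚ ys))
sumℚ-++ (x ∷ xs) ys = trans (cong (x +_) (sumℚ-++ xs ys)) (sym (+-assoc x (sumℚ xs) (sumℚ ys)))

sumℚ-↭ : ∀ {xs ys} → xs ↭ ys → sumℚ xs ≡ sumℚ ys
sumℚ-↭ π = ↭ₛ.foldr-commMonoid (setoid ℚ) +-0-isCommutativeMonoid (↭⇒↭ₛ π)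

module _ {A : Set} (g : A → ℚ) where

  sumℚ-map-↭ : ∀ {xs ys} → xs ↭ ys → sumℚ (map g xs) ≡ sumℚ (map g ys)
  sumℚ-map-↭ π = sumℚ-↭ (↭.map⁺ g π)

  sumℚ-map-nonneg : (∀ x → 0ℚ ≤ g x) → ∀ xs → 0ℚ ≤ sumℚ (map g xs)
  sumℚ-map-nonneg g≥0 []       = ≤-refl
  sumℚ-map-nonneg g≥0 (x ∷ xs) = +-mono-≤ (g≥0 x) (sumℚ-map-nonneg g≥0 xs)

  sumℚ-map-unique-⊆ : (∀ x → 0ℚ ≤ g x) → ∀ xs ys → Unique xs → All (_∈ ys) xs →
                      sumℚ (map g xs) ≤ sumℚ (map g ys)
  sumℚ-map-unique-⊆ g≥0 []       ys _            _ = sumℚ-map-nonneg g≥0 ys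
  sumℚ-map-unique-⊆ g≥0 (x ∷ xs) ys (x∉xs ∷ uxs) (x∈ys ∷ xs⊆ys)
    with _ , ys′ , refl , π ← Any-extract x∈ys = begin
      g x + sumℚ (map g xs)   ≤⟨ +-monoʳ-≤ (g x) (sumℚ-map-unique-⊆ g≥0 xs ys′ uxs xs⊆ys′) ⟩
      g x + sumℚ (map g ys′)  ≡⟨ sumℚ-map-↭ π ⟨
      sumℚ (map g ys)         ∎
    where
    open ≤-Reasoning
    other-than-x : ∀ {z} → z ∈ ys × x ≢ z → z ∈ ys′
    other-than-x (z∈ys , x≢z) with ↭.∈-resp-↭ π z∈ys
    ... | here refl   = ⊥-elim (x≢z refl)
    ... | there z∈ys′ = z∈ys′
    xs⊆ys′ : All (_∈ ys′) xs
    xs⊆ys′ = All.zipWith other-than-x (xs⊆ys , x∉xs)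

vertices  : ∀ {n} → STT n → List (Fin n)
vertices* : ∀ {n} → List (STT n) → List (Fin n)
vertices (node r ts) = r ∷ vertices* ts
vertices* []       = []
vertices* (t ∷ ts) = vertices t ++ vertices* ts

module _ {n : ℕ} (f : Fin n → ℚ) where

  weight  : STT n → ℚ
  weights : List (STT n) → ℚ
  weight (node r ts) = f r + weights ts
  weights []       = 0ℚ
  weights (t ∷ ts) = weight t + weights ts

  weight-as-sum-vertices  : ∀ t  → weight t ≡ sumℚ (map f (vertices t))
  weights-as-sum-vertices : ∀ ts → weights ts ≡ sumℚ (map f (vertices* ts))
  weight-as-sum-vertices (node r ts) = cong (f r +_) (weights-as-sum-vertices ts)
  weights-as-sum-vertices []       = refl
  weights-as-sum-vertices (t ∷ ts) = begin
    weight t + weights ts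
      ≡⟨ cong₂ _+_ (weight-as-sum-vertices t) (weights-as-sum-vertices ts) ⟩
    sumℚ (map f (vertices t)) + sumℚ (map f (vertices* ts))
      ≡⟨ sumℚ-++ (map f (vertices t)) _ ⟨
    sumℚ (map f (vertices t) ++ map f (vertices* ts))
      ≡⟨ cong sumℚ (List.map-++ f (vertices t) (vertices* ts)) ⟨
    sumℚ (map f (vertices t ++ vertices* ts))
      ∎
    where open ≡-Reasoning

  module _ (f≥0 : ∀ v → 0ℚ ≤ f v) where

    weight-nonneg : ∀ t → 0ℚ ≤ weight t
    weight-nonneg t =
      subst (0ℚ ≤_) (sym (weight-as-sum-vertices t)) (sumℚ-map-nonneg f f≥0 (vertices t))

    weights-nonneg : ∀ ts → 0ℚ ≤ weights ts
    weights-nonneg ts =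
      subst (0ℚ ≤_) (sym (weights-as-sum-vertices ts)) (sumℚ-map-nonneg f f≥0 (vertices* ts))

  weights-as-sum : ∀ ts → weights ts ≡ sumℚ (map weight ts)
  weights-as-sum []       = refl
  weights-as-sum (t ∷ ts) = cong (weight t +_) (weights-as-sum ts)

  costsAt-as-sum : ∀ d ts → costsAt f d ts ≡ sumℚ (map (costAt f d) ts)
  costsAt-as-sum d []       = refl
  costsAt-as-sum d (t ∷ ts) = cong (costAt f d t +_) (costsAt-as-sum d ts)

  weights-↭ : ∀ {ts ts′} → ts ↭ ts′ → weights ts ≡ weights ts′
  weights-↭ {ts} {ts′} π = begin
    weights ts             ≡⟨ weights-as-sum ts ⟩
    sumℚ (map weight ts)   ≡⟨ sumℚ-map-↭ weight π ⟩
    sumℚ (map weight ts′)  ≡⟨ weights-as-sum ts′ ⟨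
    weights ts′            ∎
    where open ≡-Reasoning

  costsAt-↭ : ∀ d {ts ts′} → ts ↭ ts′ → costsAt f d ts ≡ costsAt f d ts′
  costsAt-↭ d {ts} {ts′} π = begin
    costsAt f d ts               ≡⟨ costsAt-as-sum d ts ⟩
    sumℚ (map (costAt f d) ts)   ≡⟨ sumℚ-map-↭ (costAt f d) π ⟩
    sumℚ (map (costAt f d) ts′)  ≡⟨ costsAt-as-sum d ts′ ⟨
    costsAt f d ts′              ∎
    where open ≡-Reasoning

  costsAt-++ : ∀ d xs ys → costsAt f d (xs ++ ys) ≡ costsAt f d xs + costsAt f d ys
  costsAt-++ d []       ys = sym (+-identityˡ (costsAt f d ys))
  costsAt-++ d (x ∷ xs) ys =
    trans (cong (costAt f d x +_) (costsAt-++ d xs ys)) (sym (+-assoc (costAt f d x) _ _))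

  open +-*-Solver

  costAt-suc  : ∀ d t  → costAt f (suc d) t ≡ costAt f d t + weight t
  costsAt-suc : ∀ d ts → costsAt f (suc d) ts ≡ costsAt f d ts + weights ts
  costAt-suc d (node r ts) rewrite fromℕ-suc d | costsAt-suc (suc d) ts =
    solve 4 (λ a c s w → a :* (c :+ con 1ℚ) :+ (s :+ w) := (a :* c :+ s) :+ (a :+ w))
      refl (f r) (fromℕ d) (costsAt f (suc d) ts) (weights ts)
  costsAt-suc d []       = refl
  costsAt-suc d (t ∷ ts) rewrite costAt-suc d t | costsAt-suc d ts =
    solve 4 (λ a b c e → (a :+ b) :+ (c :+ e) := (a :+ c) :+ (b :+ e))
      refl (costAt f d t) (weight t) (costsAt f d ts) (weights ts)

module RotationCost {n : ℕ} (f : Fin n → ℚ) (f≥0 : ∀ v → 0ℚ ≤ f v)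
                    {p i : Fin n} {ds os ms ks : List (STT n)} (d : ℕ) (ds↭ms++ks : ds ↭ ms ++ ks) where
  open +-*-Solver

  rotation-balance : costAt f d (node i (node p (os ++ ms) ∷ ks)) + (f i + weights f ks) ≡
                     costAt f d (node p (node i ds ∷ os)) + (f p + weights f os)
  rotation-balance
    rewrite costsAt-↭ f (suc (suc d)) ds↭ms++ks
          | costsAt-++ f (suc (suc d)) ms ks | costsAt-++ f (suc (suc d)) os ms
          | costsAt-suc f (suc d) ks | costsAt-suc f (suc d) os | fromℕ-suc d =
    solve 8 (λ a b c M K O WK WO →
        (b :* c :+ ((a :* (c :+ con 1ℚ) :+ ((O :+ WO) :+ M)) :+ K)) :+ (b :+ WK)
     := (a :* c :+ ((b :* (c :+ con 1ℚ) :+ (M :+ (K :+ WK))) :+ O)) :+ (a :+ WO))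
      refl (f p) (f i) (fromℕ d) (costsAt f (suc (suc d)) ms) (costsAt f (suc d) ks)
      (costsAt f (suc d) os) (weights f ks) (weights f os)

  sinking<rising : weight f (node p (node i ds ∷ os)) < f i + f i →
                   f p + weights f os < f i + weights f ks
  sinking<rising heavy = ≰⇒> λ rising≤sinking → <-irrefl refl (begin-strict
    f i + f i
      ≤⟨ +-monoˡ-≤ (f i) (≤-trans (p≤p+q {f i} (weights-nonneg f f≥0 ks)) rising≤sinking) ⟩
    (f p + weights f os) + f i
      ≤⟨ p≤p+q (weights-nonneg f f≥0 ds) ⟩
    (f p + weights f os) + f i + weights f ds
      ≡⟨ solve 4 (λ a b O D → (a :+ O) :+ b :+ D := a :+ ((b :+ D) :+ O))
           refl (f p) (f i) (weights f os) (weights f ds) ⟩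
    weight f (node p (node i ds ∷ os))
      <⟨ heavy ⟩
    f i + f i
      ∎)
    where open ≤-Reasoning

  rotation-cheaper : weight f (node p (node i ds ∷ os)) < f i + f i →
                     costAt f d (node i (node p (os ++ ms) ∷ ks)) < costAt f d (node p (node i ds ∷ os))
  rotation-cheaper heavy = <-of-balance rotation-balance (sinking<rising heavy)

module Graph {n : ℕ} (G : Tree n) where
  open Tree G using (Adj; acyclic) renaming (sym to Adj-sym)
  open import Data.List.Membership.DecPropositional (_≟_ {n}) using (_∈?_)

  _─_ : (Fin n → Set) → Fin n → Fin n → Set
  X ─ r = _∖_ G X r

  Connected : (Fin n → Set) → Set
  Connected C = ∀ u v → C u → C v → Reach Adj C u v

  reach-head : ∀ {C u v} → Reach Adj C u v → C u
  reach-head (here c)     = c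
  reach-head (step c _ _) = c

  reach-mono : ∀ {C D : Fin n → Set} → (∀ v → C v → D v) → ∀ {u v} → Reach Adj C u v → Reach Adj D u v
  reach-mono C⊆D (here c)     = here (C⊆D _ c)
  reach-mono C⊆D (step c a r) = step (C⊆D _ c) a (reach-mono C⊆D r)

  reach-++ : ∀ {C u v w} → Reach Adj C u v → Reach Adj C v w → Reach Adj C u w
  reach-++ (here _)     r′ = r′
  reach-++ (step c a r) r′ = step c a (reach-++ r r′)

  reach-reverse : ∀ {C u v} → Reach Adj C u v → Reach Adj C v u
  reach-reverse (here c)     = here c
  reach-reverse (step c a r) = reach-++ (reach-reverse r) (step (reach-head r) (Adj-sym a) (here c))

  reach-avoiding-or-after-last-visit : ∀ {S p x v} → Reach Adj S x v → v ≢ p →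
    Reach Adj (S ─ p) x v ⊎ (∃[ w ] Adj p w × Reach Adj (S ─ p) w v)
  reach-avoiding-or-after-last-visit (here Sv) v≢p = inj₁ (here (Sv , v≢p))
  reach-avoiding-or-after-last-visit {p = p} (step {u} {w} Su a r) v≢p
    with reach-avoiding-or-after-last-visit r v≢p
  ... | inj₂ later = inj₂ later
  ... | inj₁ r′ with u ≟ p
  ...   | yes refl = inj₂ (w , a , r′)
  ...   | no u≢p   = inj₁ (step (Su , u≢p) a r′)

  reach-after-last-visit : ∀ {S p v} → Reach Adj S p v → v ≢ p → ∃[ w ] Adj p w × Reach Adj (S ─ p) w v
  reach-after-last-visit r v≢p with reach-avoiding-or-after-last-visit r v≢p
  ... | inj₁ r′   = ⊥-elim (proj₂ (reach-head r′) refl)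
  ... | inj₂ exit = exit

  component-⊆ : ∀ {X C} → IsComponent G X C → ∀ v → C v → X v
  component-⊆ (C⊆X , _) = C⊆X

  component-connected : ∀ {X C} → IsComponent G X C → Connected C
  component-connected (_ , _ , connected , _) = connected

  component-closed : ∀ {X C} → IsComponent G X C → ∀ u w → C u → X w → Adj u w → C w
  component-closed (_ , _ , _ , closed) = closed

  component-restrict : ∀ {X Y C} → IsComponent G X C → (∀ v → C v → Y v) →
                       (∀ u w → C u → Y w → Adj u w → X w) → IsComponent G Y C
  component-restrict (_ , nonempty , connected , closed) C⊆Y Y⊆X-near-C =
    C⊆Y , nonempty , connected , λ u w Cu Yw a → closed u w Cu (Y⊆X-near-C u w Cu Yw a) a

  component-≐ : ∀ {X C C′} → C ≐ C′ → IsComponent G X C → IsComponent G X C′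
  component-≐ (C⊆C′ , C′⊆C) (C⊆X , (v , Cv) , connected , closed) =
    (λ v C′v → C⊆X v (C′⊆C C′v)) , (v , C⊆C′ Cv) ,
    (λ u w C′u C′w → reach-mono (λ _ → C⊆C′) (connected u w (C′⊆C C′u) (C′⊆C C′w))) ,
    (λ u w C′u Xw a → C⊆C′ (closed u w (C′⊆C C′u) Xw a))

  reach-into-component : ∀ {X C u v} → IsComponent G X C → Reach Adj X u v → C v → Reach Adj C u v
  reach-into-component _    (here _)      Cv = here Cv
  reach-into-component comp (step Xu a r) Cv =
    let r′ = reach-into-component comp r Cv
    in step (component-closed comp _ _ (reach-head r′) Xu (Adj-sym a)) a r′

  component-neighbour : ∀ {S p C} → Connected S → S p → IsComponent G (S ─ p) C → ∃[ w ] Adj p w × C w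
  component-neighbour connected Sp comp@(C⊆S─p , (v , Cv) , _)
    with Sv , v≢p ← C⊆S─p v Cv
    with w , p~w , r ← reach-after-last-visit (connected _ v Sp Sv) v≢p =
    w , p~w , reach-head (reach-into-component comp r Cv)

  record SimplePath (C : Fin n → Set) (u v : Fin n) : Set where
    constructor simplePath
    field
      rest   : List (Fin n)
      linked : Linked Adj (u ∷ rest)
      unique : Unique (u ∷ rest)
      inside : All C (u ∷ rest)
      ends   : last (u ∷ rest) ≡ just v

  path-suffix : ∀ {C x v u} (π : SimplePath C x v) → u ∈ x ∷ SimplePath.rest π → SimplePath C u v
  path-suffix π (here refl) = π
  path-suffix (simplePath (_ ∷ xs) (_ ∷ l) (_ ∷ q) (_ ∷ c) e) (there m) =
    path-suffix (simplePath xs l q c e) m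

  simple-path : ∀ {C u v} → Reach Adj C u v → SimplePath C u v
  simple-path (here Cu) = simplePath [] [-] ([] ∷ []) (Cu ∷ []) refl
  simple-path {u = u} (step {w = w} Cu a r) with simple-path r
  ... | π@(simplePath rest linked unique inside ends) with u ∈? (w ∷ rest)
  ...   | yes u∈π = path-suffix π u∈π
  ...   | no u∉π  =
    simplePath (w ∷ rest) (a ∷ linked) (All.¬Any⇒All¬ (w ∷ rest) u∉π ∷ unique) (Cu ∷ inside) ends

  no-walk-between-neighbours : ∀ {C : Fin n → Set} {p a b} → ¬ C p → Adj p a → Adj p b → a ≢ b →
                               ¬ Reach Adj C a b
  no-walk-between-neighbours {C} {p} {a} {b} p∉C p~a p~b a≢b r
    with simplePath rest linked unique inside ends ← simple-path r =
    acyclic (p ∷ a ∷ rest) (cycle (long rest ends) ends)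
    where
    long : ∀ xs → last (a ∷ xs) ≡ just b → 3 ℕ.≤ length (p ∷ a ∷ xs)
    long []      refl = ⊥-elim (a≢b refl)
    long (_ ∷ _) _    = ℕ.s≤s (ℕ.s≤s (ℕ.s≤s ℕ.z≤n))
    p∉path : All (p ≢_) (a ∷ rest)
    p∉path = All.map (λ Cx p≡x → p∉C (subst C (sym p≡x) Cx)) inside
    cycle : 3 ℕ.≤ length (p ∷ a ∷ rest) → last (a ∷ rest) ≡ just b → IsCycle Adj (p ∷ a ∷ rest)
    cycle ℓ e with last (a ∷ rest) | e
    ... | just .b | refl = ℓ , p∉path ∷ unique , p~a ∷ linked , Adj-sym p~b

module SearchTrees {n : ℕ} (G : Tree n) where
  open Tree G using (Adj)
  open Graph G

  Disjoint : STT n → STT n → Set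
  Disjoint t t′ = ∀ v → v ∈T t → v ∈T t′ → ⊥

  Disjoint-sym : ∀ {t t′} → Disjoint t t′ → Disjoint t′ t
  Disjoint-sym d v v∈t′ v∈t = d v v∈t v∈t′

  Touches : Fin n → STT n → Set
  Touches r c = ∃[ w ] Adj r w × w ∈T c

  ComponentSTT : (Fin n → Set) → STT n → Set
  ComponentSTT X t = IsComponent G X (nodes t) × IsSTT G (nodes t) t

  stt-root : ∀ {S r ts} → IsSTT G S (node r ts) → S r
  stt-root (mk Sr _ _ _) = Sr

  stt-children : ∀ {S r ts} → IsSTT G S (node r ts) → All (ComponentSTT (S ─ r)) ts
  stt-children (mk _ children _ _) = children

  stt-covers : ∀ {S r ts} → IsSTT G S (node r ts) → ∀ v → (S ─ r) v → Any (v ∈T_) ts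
  stt-covers (mk _ _ covers _) = covers

  stt-disjoint : ∀ {S r ts} → IsSTT G S (node r ts) → AllPairs Disjoint ts
  stt-disjoint (mk _ _ _ disjoint) = disjoint

  children-⊆ : ∀ {X ts v} → All (ComponentSTT X) ts → Any (v ∈T_) ts → X v
  children-⊆ children v∈ts with (comp , _) , v∈t ← All.lookupAny children v∈ts = component-⊆ comp _ v∈t

  children-closed : ∀ {X ts u w} → All (ComponentSTT X) ts → Any (u ∈T_) ts → X w → Adj u w →
                    Any (w ∈T_) ts
  children-closed ((comp , _) ∷ _) (here u∈t)    Xw a = here (component-closed comp _ _ u∈t Xw a)
  children-closed (_ ∷ children)   (there u∈ts)  Xw a = there (children-closed children u∈ts Xw a)

  disjoint-from : ∀ {t ts v} → All (Disjoint t) ts → v ∈T t → ¬ Any (v ∈T_) ts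
  disjoint-from (d ∷ _)  v∈t (here v∈t′)  = d _ v∈t v∈t′
  disjoint-from (_ ∷ ds) v∈t (there v∈ts) = disjoint-from ds v∈t v∈ts

  apart-from : ∀ {xs ys v} → All (λ x → All (Disjoint x) ys) xs → Any (v ∈T_) xs → ¬ Any (v ∈T_) ys
  apart-from (d ∷ _)  (here v∈x)   = disjoint-from d v∈x
  apart-from (_ ∷ ds) (there v∈xs) = apart-from ds v∈xs

  stt-sound : ∀ {S T v} → IsSTT G S T → v ∈T T → S v
  stt-sound (mk Sr _ _ _)       here         = Sr
  stt-sound (mk _ children _ _) (there v∈ts) = proj₁ (children-⊆ children v∈ts)

  stt-complete : ∀ {S T v} → IsSTT G S T → S v → v ∈T T
  stt-complete {v = v} (mk {r} _ _ covers _) Sv with v ≟ r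
  ... | yes refl = here
  ... | no v≢r   = there (covers v (Sv , v≢r))

  stt-nodes : ∀ {S T} → IsSTT G S T → nodes T ≐ S
  stt-nodes valid = stt-sound valid , stt-complete valid

  stt-≐ : ∀ {S S′ T} → S ≐ S′ → IsSTT G S T → IsSTT G S′ T
  stt-≐ {S} {S′} (S⊆S′ , S′⊆S) (mk {r} Sr children covers disjoint) =
    mk (S⊆S′ Sr) (All.map transport children) (λ v (S′v , v≢r) → covers v (S′⊆S S′v , v≢r)) disjoint
    where
    transport : ∀ {t} → ComponentSTT (S ─ r) t → ComponentSTT (S′ ─ r) t
    transport (comp , valid) =
      component-restrict comp (λ v Cv → let (Sv , v≢r) = component-⊆ comp v Cv in S⊆S′ Sv , v≢r)
                              (λ _ _ _ (S′w , w≢r) _ → S′⊆S S′w , w≢r) ,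
      valid

  stt-children-↭ : ∀ {S r ts ts′} → ts ↭ ts′ → IsSTT G S (node r ts) → IsSTT G S (node r ts′)
  stt-children-↭ π (mk Sr children covers disjoint) =
    mk Sr (↭.All-resp-↭ π children) (λ v x → ↭.Any-resp-↭ π (covers v x))
       (↭ₛ.AllPairs-resp-↭ (setoid (STT n)) Disjoint-sym (resp₂ Disjoint) (↭⇒↭ₛ π) disjoint)

  reach-from-neighbour : ∀ {X r cs v} → All (ComponentSTT X) cs → All (Touches r) cs →
                         Any (v ∈T_) cs → ∃[ w ] Adj r w × Reach Adj (λ u → Any (u ∈T_) cs) w v
  reach-from-neighbour ((comp , _) ∷ _) ((w , r~w , w∈c) ∷ _) (here v∈c) =
    w , r~w , reach-mono (λ _ → here) (component-connected comp w _ w∈c v∈c)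
  reach-from-neighbour (_ ∷ children) (_ ∷ touches) (there v∈cs)
    with w , r~w , walk ← reach-from-neighbour children touches v∈cs =
    w , r~w , reach-mono (λ _ → there) walk

  nodes-connected : ∀ {X r cs} → All (ComponentSTT X) cs → All (Touches r) cs →
                    Connected (nodes (node r cs))
  nodes-connected {r = r} {cs} children touches u v u∈ v∈ =
    reach-++ (reach-reverse (from-root u∈)) (from-root v∈)
    where
    from-root : ∀ {v} → v ∈T node r cs → Reach Adj (nodes (node r cs)) r v
    from-root here         = here here
    from-root (there v∈cs) with w , r~w , walk ← reach-from-neighbour children touches v∈cs =
      step here r~w (reach-mono (λ _ → there) walk)

  ∈vertices⇒∈T  : ∀ {v : Fin n} t  → v ∈ vertices t → v ∈T t
  ∈vertices*⇒∈T : ∀ {v : Fin n} ts → v ∈ vertices* ts → Any (v ∈T_) ts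
  ∈vertices⇒∈T (node r ts) (here refl) = here
  ∈vertices⇒∈T (node r ts) (there v∈)  = there (∈vertices*⇒∈T ts v∈)
  ∈vertices*⇒∈T (t ∷ ts) v∈ with Any.++⁻ (vertices t) v∈
  ... | inj₁ v∈t  = here (∈vertices⇒∈T t v∈t)
  ... | inj₂ v∈ts = there (∈vertices*⇒∈T ts v∈ts)

  vertices-unique  : ∀ {S T} → IsSTT G S T → Unique (vertices T)
  vertices*-unique : ∀ {X ts} → All (ComponentSTT X) ts → AllPairs Disjoint ts → Unique (vertices* ts)
  vertices-unique (mk {r} {ts} _ children _ disjoint) =
    All.¬Any⇒All¬ (vertices* ts) (λ r∈ → proj₂ (children-⊆ children (∈vertices*⇒∈T ts r∈)) refl) ∷
    vertices*-unique children disjoint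
  vertices*-unique [] [] = []
  vertices*-unique {ts = t ∷ ts} ((_ , valid) ∷ children) (t-apart ∷ disjoint) =
    Unique.++⁺ (vertices-unique valid) (vertices*-unique children disjoint)
      (λ (v∈t , v∈ts) → disjoint-from t-apart (∈vertices⇒∈T t v∈t) (∈vertices*⇒∈T ts v∈ts))

module Rotation {n : ℕ} (G : Tree n)
  {S : Fin n → Set} (S-connected : Graph.Connected G S)
  {p i : Fin n} {ds os ms ks : List (STT n)}
  (valid : IsSTT G S (node p (node i ds ∷ os)))
  (ds↭ms++ks : ds ↭ ms ++ ks)
  (ms-touch : All (SearchTrees.Touches G p) ms)
  (ks-detached : ∀ {u} → Any (u ∈T_) ks → ¬ Tree.Adj G u p)
  where
  open Tree G using (Adj) renaming (sym to Adj-sym)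
  open Graph G
  open SearchTrees G

  C : Fin n → Set
  C = nodes (node i ds)

  Rt : STT n
  Rt = node p (os ++ ms)

  R : Fin n → Set
  R = nodes Rt

  t-component : IsComponent G (S ─ p) C
  t-component = proj₁ (All.head (stt-children valid))

  t-valid : IsSTT G C (node i (ms ++ ks))
  t-valid = stt-children-↭ ds↭ms++ks (proj₂ (All.head (stt-children valid)))

  os-children : All (ComponentSTT (S ─ p)) os
  os-children = All.tail (stt-children valid)

  ms-children : All (ComponentSTT (C ─ i)) ms
  ms-children = All.++⁻ˡ ms (stt-children t-valid)

  ks-children : All (ComponentSTT (C ─ i)) ks
  ks-children = All.++⁻ʳ ms (stt-children t-valid)

  ms-disjoint : AllPairs Disjoint ms
  ms-disjoint = proj₁ (AllPairs-++⁻ ms (stt-disjoint t-valid))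

  ks-disjoint : AllPairs Disjoint ks
  ks-disjoint = proj₁ (proj₂ (AllPairs-++⁻ ms (stt-disjoint t-valid)))

  ms-apart-ks : All (λ m → All (Disjoint m) ks) ms
  ms-apart-ks = proj₂ (proj₂ (AllPairs-++⁻ ms (stt-disjoint t-valid)))

  p∉C : ¬ C p
  p∉C Cp = proj₂ (component-⊆ t-component _ Cp) refl

  C⊆S : ∀ {v} → C v → S v
  C⊆S Cv = proj₁ (component-⊆ t-component _ Cv)

  os∌C : ∀ {v} → Any (v ∈T_) os → ¬ C v
  os∌C v∈os Cv = disjoint-from (AllPairs.head (stt-disjoint valid)) Cv v∈os

  ms⊆C─i : ∀ {v} → Any (v ∈T_) ms → (C ─ i) v
  ms⊆C─i = children-⊆ ms-children

  ks⊆C─i : ∀ {v} → Any (v ∈T_) ks → (C ─ i) v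
  ks⊆C─i = children-⊆ ks-children

  R⊆S─i : ∀ v → R v → (S ─ i) v
  R⊆S─i _ here = stt-root valid , λ p≡i → p∉C (subst C (sym p≡i) here)
  R⊆S─i v (there v∈) with Any.++⁻ os v∈
  ... | inj₁ v∈os = proj₁ (children-⊆ os-children v∈os) , λ v≡i → os∌C v∈os (subst C (sym v≡i) here)
  ... | inj₂ v∈ms = C⊆S (proj₁ (ms⊆C─i v∈ms)) , proj₂ (ms⊆C─i v∈ms)

  R─p⊆S─p : ∀ {v} → (R ─ p) v → (S ─ p) v
  R─p⊆S─p (Rv , v≢p) = proj₁ (R⊆S─i _ Rv) , v≢p

  S─i─p-cases : ∀ {v} → (S ─ i) v → v ≢ p → Any (v ∈T_) (os ++ ms) ⊎ Any (v ∈T_) ks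
  S─i─p-cases {v} (Sv , v≢i) v≢p with stt-covers valid v (Sv , v≢p)
  ... | there v∈os = inj₁ (Any.++⁺ˡ v∈os)
  ... | here v∈t with Any.++⁻ ms (stt-covers t-valid v (v∈t , v≢i))
  ...   | inj₁ v∈ms = inj₁ (Any.++⁺ʳ os v∈ms)
  ...   | inj₂ v∈ks = inj₂ v∈ks

  Rt-children : All (ComponentSTT (R ─ p)) (os ++ ms)
  Rt-children = All.++⁺ (All.tabulate os-child) (All.tabulate ms-child)
    where
    os-child : ∀ {o} → o ∈ os → ComponentSTT (R ─ p) o
    os-child o∈os with comp , o-valid ← All.lookup os-children o∈os =
      component-restrict comp
        (λ v v∈o → there (Any.++⁺ˡ (lose o∈os v∈o)) , proj₂ (component-⊆ comp v v∈o))
        (λ _ _ _ R─p-w _ → R─p⊆S─p R─p-w) ,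
      o-valid
    ms-child : ∀ {m} → m ∈ ms → ComponentSTT (R ─ p) m
    ms-child m∈ms with comp , m-valid ← All.lookup ms-children m∈ms =
      component-restrict comp
        (λ v v∈m → there (Any.++⁺ʳ os (lose m∈ms v∈m)) ,
                   λ v≡p → p∉C (subst C v≡p (proj₁ (ms⊆C─i (lose m∈ms v∈m)))))
        (λ u w u∈m (Rw , w≢p) a →
           component-closed t-component u w (proj₁ (ms⊆C─i (lose m∈ms u∈m))) (R─p⊆S─p (Rw , w≢p)) a ,
           proj₂ (R⊆S─i w Rw)) ,
      m-valid

  Rt-disjoint : AllPairs Disjoint (os ++ ms)
  Rt-disjoint = AllPairs.++⁺ (AllPairs.tail (stt-disjoint valid)) ms-disjoint
    (All.tabulate λ o∈os → All.tabulate λ m∈ms v v∈o v∈m →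
      os∌C (lose o∈os v∈o) (proj₁ (ms⊆C─i (lose m∈ms v∈m))))

  Rt-valid : IsSTT G R Rt
  Rt-valid = mk here Rt-children Rt-covers Rt-disjoint
    where
    Rt-covers : ∀ v → (R ─ p) v → Any (v ∈T_) (os ++ ms)
    Rt-covers v (here     , v≢p) = ⊥-elim (v≢p refl)
    Rt-covers v (there v∈ , _)   = v∈

  R-connected : Connected R
  R-connected = nodes-connected Rt-children (All.++⁺ os-touch ms-touch)
    where
    os-touch : All (Touches p) os
    os-touch = All.map (λ (comp , _) → component-neighbour S-connected (stt-root valid) comp) os-children

  R-closed-off-p : ∀ {u w} → R u → (S ─ i) w → w ≢ p → Adj u w → R w
  R-closed-off-p here S─i-w w≢p p~w with S─i─p-cases S─i-w w≢p
  ... | inj₁ w∈   = there w∈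
  ... | inj₂ w∈ks = ⊥-elim (ks-detached w∈ks (Adj-sym p~w))
  R-closed-off-p {u} {w} (there u∈) (Sw , w≢i) w≢p a with Any.++⁻ os u∈
  ... | inj₁ u∈os = there (Any.++⁺ˡ (children-closed os-children u∈os (Sw , w≢p) a))
  ... | inj₂ u∈ms = there (Any.++⁺ʳ os (children-closed ms-children u∈ms (Cw , w≢i) a))
    where
    Cw : C w
    Cw = component-closed t-component u w (proj₁ (ms⊆C─i u∈ms)) (Sw , w≢p) a

  R-component : IsComponent G (S ─ i) R
  R-component = R⊆S─i , (p , here) , R-connected , R-closed
    where
    R-closed : ∀ u w → R u → (S ─ i) w → Adj u w → R w
    R-closed u w Ru S─i-w a with w ≟ p
    ... | yes refl = here
    ... | no w≢p   = R-closed-off-p Ru S─i-w w≢p a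

  ks-components : All (ComponentSTT (S ─ i)) ks
  ks-components = All.tabulate k-child
    where
    stays-in-C : ∀ {u w} → Any (u ∈T_) ks → (S ─ i) w → Adj u w → (C ─ i) w
    stays-in-C {w = w} u∈ks (Sw , w≢i) a with w ≟ p
    ... | yes refl = ⊥-elim (ks-detached u∈ks a)
    ... | no w≢p   = component-closed t-component _ w (proj₁ (ks⊆C─i u∈ks)) (Sw , w≢p) a , w≢i
    k-child : ∀ {k} → k ∈ ks → ComponentSTT (S ─ i) k
    k-child k∈ks with comp , k-valid ← All.lookup ks-children k∈ks =
      component-restrict comp
        (λ v v∈k → C⊆S (proj₁ (ks⊆C─i (lose k∈ks v∈k))) , proj₂ (ks⊆C─i (lose k∈ks v∈k)))
        (λ u w u∈k → stays-in-C (lose k∈ks u∈k)) ,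
      k-valid

  rotated-covers : ∀ v → (S ─ i) v → Any (v ∈T_) (Rt ∷ ks)
  rotated-covers v S─i-v with v ≟ p
  ... | yes refl = here here
  ... | no v≢p with S─i─p-cases S─i-v v≢p
  ...   | inj₁ v∈   = here (there v∈)
  ...   | inj₂ v∈ks = there v∈ks

  Rt-apart-ks : All (Disjoint Rt) ks
  Rt-apart-ks = All.tabulate λ k∈ks v v∈Rt v∈k → apart v∈Rt (lose k∈ks v∈k)
    where
    apart : ∀ {v} → v ∈T Rt → ¬ Any (v ∈T_) ks
    apart here v∈ks = p∉C (proj₁ (ks⊆C─i v∈ks))
    apart (there v∈) v∈ks with Any.++⁻ os v∈
    ... | inj₁ v∈os = os∌C v∈os (proj₁ (ks⊆C─i v∈ks))
    ... | inj₂ v∈ms = apart-from ms-apart-ks v∈ms v∈ks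

  rotation-valid : IsSTT G S (node i (Rt ∷ ks))
  rotation-valid =
    mk (C⊆S here) ((R-component , Rt-valid) ∷ ks-components) rotated-covers (Rt-apart-ks ∷ ks-disjoint)

module Improvement {n : ℕ} (G : Tree n) (f : Fin n → ℚ) (f≥0 : ∀ v → 0ℚ ≤ f v) where
  open Tree G using (Adj) renaming (sym to Adj-sym)
  open Graph G
  open SearchTrees G
  open RotationCost f f≥0 using (rotation-cheaper)

  Improvable : (Fin n → Set) → ℕ → STT n → Set
  Improvable S d T = ∃[ T′ ] IsSTT G S T′ × costAt f d T′ < costAt f d T

  improvable-↭ : ∀ {S d p ts ts′} → ts ↭ ts′ → Improvable S d (node p ts′) → Improvable S d (node p ts)
  improvable-↭ {d = d} {p} π (T′ , valid , cheaper) =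
    T′ , valid ,
    subst (costAt f d T′ <_) (cong (f p * fromℕ d +_) (costsAt-↭ f (suc d) (↭-sym π))) cheaper

  improve-first-child : ∀ {S d p t ts} → IsSTT G S (node p (t ∷ ts)) → Improvable (nodes t) (suc d) t →
                        Improvable S d (node p (t ∷ ts))
  improve-first-child {S} {d} {p} {t} {ts} (mk Sp ((comp , _) ∷ children) covers (t-apart ∷ disjoint))
                      (t′ , t′-valid , cheaper) =
    node p (t′ ∷ ts) ,
    mk Sp ((component-≐ t≐t′ comp , stt-≐ t≐t′ t′-valid) ∷ children) covers′
       (All.map (λ t-apart-c v v∈t′ v∈c → t-apart-c v (proj₂ t≐t′ v∈t′) v∈c) t-apart ∷ disjoint) ,
    +-monoʳ-< (f p * fromℕ d) (+-monoˡ-< (costsAt f (suc d) ts) cheaper)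
    where
    t≐t′ : nodes t ≐ nodes t′
    t≐t′ = ≐-sym (stt-nodes t′-valid)
    covers′ : ∀ v → (S ─ p) v → Any (v ∈T_) (t′ ∷ ts)
    covers′ v S─p-v with covers v S─p-v
    ... | here v∈t   = here (proj₁ t≐t′ v∈t)
    ... | there v∈ts = there v∈ts

  Split : Fin n → List (STT n) → Set
  Split p ds = ∃₂ λ ms ks → ds ↭ ms ++ ks × All (Touches p) ms × (∀ {u} → Any (u ∈T_) ks → ¬ Adj u p)

  children-split : ∀ {S p i ds os} → Connected S → IsSTT G S (node p (node i ds ∷ os)) → Split p ds
  children-split {S} {p} {i} {ds} connected valid =
    split (component-neighbour connected (stt-root valid) t-component)
    where
    t-component : IsComponent G (S ─ p) (nodes (node i ds))
    t-component = proj₁ (All.head (stt-children valid))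
    t-valid : IsSTT G (nodes (node i ds)) (node i ds)
    t-valid = proj₂ (All.head (stt-children valid))
    only-neighbour : ∀ {u w} → Adj p w → w ∈T node i ds → u ∈T node i ds → u ≢ w → ¬ Adj u p
    only-neighbour p~w w∈t u∈t u≢w u~p =
      no-walk-between-neighbours (λ p∈t → proj₂ (component-⊆ t-component p p∈t) refl)
        (Adj-sym u~p) p~w u≢w (component-connected t-component _ _ u∈t w∈t)
    split : Touches p (node i ds) → Split p ds
    split (_ , p~i , here) =
      [] , ds , ↭-refl , [] ,
      λ u∈ds → only-neighbour p~i here (there u∈ds) (proj₂ (children-⊆ (stt-children t-valid) u∈ds))
    split (w , p~w , there w∈ds) with m , ks , w∈m , π ← Any-extract w∈ds =
      m ∷ [] , ks , π , (w , p~w , w∈m) ∷ [] ,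
      λ u∈ks → only-neighbour p~w (there w∈ds) (there (↭.Any-resp-↭ (↭-sym π) (there u∈ks)))
                 (λ { refl → disjoint-from m-apart-ks w∈m u∈ks })
      where
      m-apart-ks : All (Disjoint m) ks
      m-apart-ks = AllPairs.head (stt-disjoint (stt-children-↭ π t-valid))

  rotate-up : ∀ {S p i ds os} d → Connected S → IsSTT G S (node p (node i ds ∷ os)) →
              weight f (node p (node i ds ∷ os)) < f i + f i → Improvable S d (node p (node i ds ∷ os))
  rotate-up {p = p} {i} {os = os} d connected valid heavy
    with ms , ks , π , ms-touch , ks-detached ← children-split connected valid =
    node i (node p (os ++ ms) ∷ ks) ,
    Rotation.rotation-valid G connected valid π ms-touch ks-detached ,
    rotation-cheaper {os = os} {ms = ms} {ks = ks} d π heavy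

  module _ (i : Fin n) where

    descend : ∀ {S T} → Connected S → IsSTT G S T → i ∈T T → root T ≢ i → weight f T < f i + f i →
              ∀ d → Improvable S d T
    descend-children : ∀ {X ts} → All (ComponentSTT X) ts → Any (i ∈T_) ts → weights f ts < f i + f i →
                       ∀ d → Any (λ t → root t ≡ i ⊎ Improvable (nodes t) (suc d) t) ts
    descend _ _ here i≢i _ _ = ⊥-elim (i≢i refl)
    descend {T = node p ts} connected valid (there i∈ts) _ heavy d
      with Any-extract (descend-children (stt-children valid) i∈ts (≤-<-trans (p≤q+p (f≥0 p)) heavy) d)
    ... | node _ ds , os , inj₁ refl , π =
      improvable-↭ π (rotate-up d connected (stt-children-↭ π valid)
                        (subst (_< f i + f i) (cong (f p +_) (weights-↭ f π)) heavy))
    ... | _ , _ , inj₂ better , π = improvable-↭ π (improve-first-child (stt-children-↭ π valid) better)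
    descend-children {ts = t ∷ ts} ((comp , t-valid) ∷ _) (here i∈t) heavy d with root t ≟ i
    ... | yes root≡i = here (inj₁ root≡i)
    ... | no root≢i  = here (inj₂ (descend (component-connected comp) t-valid i∈t root≢i
                                     (≤-<-trans (p≤p+q (weights-nonneg f f≥0 ts)) heavy) (suc d)))
    descend-children {ts = t ∷ _} (_ ∷ children) (there i∈ts) heavy d =
      there (descend-children children i∈ts (≤-<-trans (p≤q+p (weight-nonneg f f≥0 t)) heavy) d)

  heavy-vertex-is-root : ∀ {S T i} → Connected S → IsSTT G S T → S i → weight f T < f i + f i →
                         (∀ T′ → IsSTT G S T′ → cost f T ≤ cost f T′) → root T ≡ i
  heavy-vertex-is-root {T = T} {i} connected valid Si heavy optimal with root T ≟ i
  ... | yes root≡i = root≡i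
  ... | no root≢i
    with T′ , valid′ , cheaper ← descend i connected valid (stt-complete valid Si) root≢i heavy 1 =
    ⊥-elim (<-irrefl refl (≤-<-trans (optimal T′ valid′) cheaper))

  weight≤total : ∀ {S T} → IsSTT G S T → weight f T ≤ total f
  weight≤total {T = T} valid = begin
    weight f T                 ≡⟨ weight-as-sum-vertices f T ⟩
    sumℚ (map f (vertices T))  ≤⟨ sumℚ-map-unique-⊆ f f≥0 (vertices T) (allFin n) (vertices-unique valid)
                                                    (All.tabulate λ {v} _ → ∈-allFin v) ⟩
    total f                    ∎
    where open ≤-Reasoning

corollary3p5 : ∀ {n : ℕ} (U : Tree n) (f : Fin n → ℚ) →
    (∀ v → 0ℚ ≤ f v) → total f ≡ 1ℚ →
    (i : Fin n) → ½ < f i →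
    (T : STT n) → IsOptimal U f T → root T ≡ i
corollary3p5 U f f≥0 total≡1 i ½<fi T (valid , optimal) =
  heavy-vertex-is-root (λ u v _ _ → Tree.connected U u v) valid tt heavy optimal
  where
  open Improvement U f f≥0
  open ≤-Reasoning
  heavy : weight f T < f i + f i
  heavy = begin-strict
    weight f T  ≤⟨ weight≤total valid ⟩
    total f     ≡⟨ total≡1 ⟩
    ½ + ½       <⟨ +-mono-< ½<fi ½<fi ⟩
    f i + f i   ∎
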